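{- Let $\mathcal G$ be a temporal $k$-path graph with base-paths $\mathcal P=\{P_1,\dots,P_k\}$. For any two vertices $u,v$ such that $u$ reaches $v$, there is a temporal path from $u$ to $v$ that uses at most one contiguous segment from each base-path; that is, its sequence of temporal edges can be split into consecutive blocks, each block being a contiguous subpath of a single base-path, with different blocks coming from different base-paths.
   Context: A temporal multigraph $\mathcal G=(V,E,\lambda)$ consists of a directed multigraph $(V,E)$ and a labeling $\lambda$ assigning integer time labels to edges; a pair $(e,t)$ with $t\in\lambda(e)$ is a temporal edge. A temporal path is a sequence of temporal edges $((e_1,t_1),\dots,(e_m,t_m))$ such that $e_1,\dots,e_m$ form a directed path (head of $e_i$ equals tail of $e_{i+1}$) and $t_1<\dots<t_m$. A vertex $u$ reaches $v$ if there is a temporal path from $u$ to $v$. A temporal $k$-path graph is a temporal multigraph $\mathcal G$ together with a collection $\mathcal P=\{P_1,\dots,P_k\}$ of temporal paths (base-paths) whose multiset union of temporal edges is exactly the multiset of temporal edges of $\mathcal G$; so each temporal edge belongs to a unique base-path. -}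

module Defs where

open import Data.Nat using (ℕ)
open import Data.Fin using (Fin; toℕ)
open import Data.Integer using (ℤ; _<_)
open import Data.List using (List; []; _∷_; _++_; length; lookup; concat; map)
open import Data.List.Relation.Unary.All using (All)
open import Data.List.Relation.Unary.Linked using (Linked)
open import Data.List.Relation.Unary.Unique.Propositional using (Unique)
open import Data.Product using (Σ; ∃; ∃-syntax; _×_; _,_; proj₁; proj₂)
open import Function.Bundles using (_⇔_)
open import Relation.Binary.PropositionalEquality using (_≡_)

record TemporalMultigraph : Set₁ where
  field
    n m   : ℕ
    tail  : Fin m → Fin n
    head  : Fin m → Fin n
    label : Fin m → ℤ → Set

  Vertex : Set
  Vertex = Fin n

  TEdge : Set
  TEdge = Fin m × ℤ

  IsTemporalEdge : TEdge → Set
  IsTemporalEdge (e , t) = label e t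

  Consecutive : TEdge → TEdge → Set
  Consecutive (e , t) (e' , t') = head e ≡ tail e' × t < t'

  IsTemporalPath : List TEdge → Set
  IsTemporalPath es = All IsTemporalEdge es × Linked Consecutive es

  FromTo : Vertex → Vertex → List TEdge → Set
  FromTo u v []             = u ≡ v
  FromTo u v ((e , t) ∷ es) = tail e ≡ u × FromTo (head e) v es

  TemporalPathFromTo : Vertex → Vertex → List TEdge → Set
  TemporalPathFromTo u v es = IsTemporalPath es × FromTo u v es

  Reaches : Vertex → Vertex → Set
  Reaches u v = ∃[ es ] TemporalPathFromTo u v es

ContiguousIn : {A : Set} → List A → List A → Set
ContiguousIn b p = ∃[ pre ] ∃[ suf ] (pre ++ b ++ suf ≡ p)

-- A temporal k-path graph: G together with k base-paths, each a temporal
-- path of G, such that the multiset union of their temporal edges is exactly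
-- the set of temporal edges of G (each temporal edge occurs exactly once
-- among all positions of all base-paths, and nothing else occurs).
record TemporalKPathGraph : Set₁ where
  field
    G : TemporalMultigraph
  open TemporalMultigraph G public
  field
    k      : ℕ
    base   : Fin k → List TEdge
    isPath : ∀ i → IsTemporalPath (base i)
    cover  : ∀ e t → label e t ⇔ (∃[ i ] ∃[ p ] (lookup (base i) p ≡ (e , t)))
    once   : ∀ i j (p : Fin (length (base i))) (q : Fin (length (base j))) →
             lookup (base i) p ≡ lookup (base j) q → i ≡ j × toℕ p ≡ toℕ q

  OneSegmentPerBasePath : List TEdge → Set
  OneSegmentPerBasePath es =
    ∃[ blocks ] (concat (map proj₂ blocks) ≡ es
                 × All (λ (ib : Fin k × List TEdge) → ContiguousIn (proj₂ ib) (base (proj₁ ib))) blocks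
                 × Unique (map proj₁ blocks))

{-# OPTIONS --safe #-}
-- Take a temporal path from u to v and let x be its first edge, lying on the
-- base-path P. Let y be the last edge of the path that lies on P. Since times
-- increase along both the path and P, y comes no earlier than x on P, so the
-- segment of P from x to y is a temporal path from u to the head of y, ending
-- with the same temporal edge as the prefix of the path it replaces. The rest
-- of the path after y avoids P entirely, so recursively shortcutting it only
-- ever uses base-paths other than P.
module Submission where

open import Defs
open import Data.Product using (∃-syntax; _×_; _,_; proj₁; proj₂)
open import Data.Product.Properties using (≡-dec)
open import Data.Nat using (_<_)
open import Data.Nat.Induction using (<-wellFounded)
open import Data.Fin using (Fin)
import Data.Fin as Fin
import Data.Integer as ℤ
open import Data.Integer.Properties using (<-trans; <-irrefl; <-asym)
open import Data.List as List using (List; []; _∷_; _++_; _∷ʳ_; length; concat; map)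
open import Data.List.Properties using (++-assoc; length-++-≤ʳ)
open import Data.List.Relation.Unary.All as All using (All; []; _∷_)
open import Data.List.Relation.Unary.All.Properties using (++⁻ˡ; ++⁻ʳ; ++⁺; ¬Any⇒All¬; All¬⇒¬Any)
open import Data.List.Relation.Unary.Any using (Any; here; there; any?)
open import Data.List.Relation.Unary.Any.Properties using (++⁺ʳ)
open import Data.List.Relation.Unary.AllPairs using (AllPairs; []; _∷_)
open import Data.List.Relation.Unary.Unique.Propositional using (Unique)
open import Data.List.Relation.Unary.Linked as Linked using (Linked; []; [-]; _∷_; _∷′_)
open import Data.List.Relation.Unary.Linked.Properties using (Linked⇒AllPairs)
open import Data.List.Membership.Propositional using (_∈_; _∉_)
open import Data.List.Membership.Propositional.Properties using (∈-∃++; ∈-++⁻; ∈-insert; ∈-lookup)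
open import Data.Maybe using (just)
open import Data.Maybe.Relation.Binary.Connected using (Connected)
open import Data.Sum using (inj₁; inj₂)
open import Function using (_∘_)
open import Function.Bundles using (Equivalence)
open import Induction.WellFounded using (Acc; acc)
open import Relation.Nullary using (¬_; yes; no; contradiction)
open import Relation.Unary using (Decidable)
open import Relation.Binary.PropositionalEquality using (_≡_; _≢_; refl; sym; trans; cong; subst)

module _ {A : Set} where

  split-last : {P : A → Set} → Decidable P → ∀ {xs} → Any P xs →
               ∃[ pre ] ∃[ y ] ∃[ suf ] (xs ≡ pre ++ y ∷ suf × P y × All (¬_ ∘ P) suf)
  split-last P? {x ∷ xs} P[x∷xs] with any? P? xs | P[x∷xs]
  ... | yes P[xs] | _ = let pre , y , suf , eq , Py , ¬P[suf] = split-last P? P[xs]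
                        in x ∷ pre , y , suf , cong (x ∷_) eq , Py , ¬P[suf]
  ... | no ¬P[xs] | here Px     = [] , x , xs , refl , Px , ¬Any⇒All¬ xs ¬P[xs]
  ... | no ¬P[xs] | there P[xs] = contradiction P[xs] ¬P[xs]

  head-++ : ∀ xs ys {x : A} → List.head xs ≡ just x → List.head (xs ++ ys) ≡ just x
  head-++ (_ ∷ _) _ eq = eq

  module _ {R : A → A → Set} where

    Linked-++⁻ˡ : ∀ xs {ys} → Linked R (xs ++ ys) → Linked R xs
    Linked-++⁻ˡ []           _       = []
    Linked-++⁻ˡ (_ ∷ [])     _       = [-]
    Linked-++⁻ˡ (_ ∷ _ ∷ xs) (r ∷ l) = r ∷ Linked-++⁻ˡ (_ ∷ xs) l

    Linked-++⁻ʳ : ∀ xs {ys} → Linked R (xs ++ ys) → Linked R ys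
    Linked-++⁻ʳ []       l = l
    Linked-++⁻ʳ (_ ∷ xs) l = Linked-++⁻ʳ xs (Linked.tail l)

    Linked-∷ʳ-++ : ∀ xs {y zs} → Linked R (xs ∷ʳ y) → Linked R (y ∷ zs) → Linked R ((xs ∷ʳ y) ++ zs)
    Linked-∷ʳ-++ []           _        l = l
    Linked-∷ʳ-++ (_ ∷ [])     (r ∷ _)  l = r ∷ l
    Linked-∷ʳ-++ (_ ∷ _ ∷ xs) (r ∷ l₁) l = r ∷ Linked-∷ʳ-++ (_ ∷ xs) l₁ l

    AllPairs-++⇒related : ∀ xs {ys x y} → AllPairs R (xs ++ ys) → x ∈ xs → y ∈ ys → R x y
    AllPairs-++⇒related (_ ∷ xs) (Rx ∷ _)  (here refl) y∈ys = All.lookup (++⁻ʳ xs Rx) y∈ys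
    AllPairs-++⇒related (_ ∷ xs) (_ ∷ Rxs) (there x∈xs) y∈ys = AllPairs-++⇒related xs Rxs x∈xs y∈ys

    segment-from-to : ∀ {xs x y} → AllPairs R xs → x ∈ xs → y ∈ xs → ¬ R y x →
                      ∃[ C ] (ContiguousIn (C ∷ʳ y) xs × List.head (C ∷ʳ y) ≡ just x)
    segment-from-to {y = y} sorted x∈xs y∈xs ¬Ryx with ∈-∃++ x∈xs
    ... | pre , post , refl with ∈-++⁻ pre y∈xs
    ... | inj₁ y∈pre = contradiction (AllPairs-++⇒related pre sorted y∈pre (here refl)) ¬Ryx
    ... | inj₂ y∈x∷post with ∈-∃++ y∈x∷post
    ... | C , D , x∷post≡ = C , (pre , D , cong (pre ++_) (trans (++-assoc C _ D) (sym x∷post≡))) , starts C x∷post≡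
      where
      starts : ∀ C {x post D} → x ∷ post ≡ C ++ y ∷ D → List.head (C ∷ʳ y) ≡ just x
      starts []      refl = refl
      starts (_ ∷ _) refl = refl

module _ (H : TemporalKPathGraph) where
  open TemporalKPathGraph H
  open import Data.List.Membership.DecPropositional (≡-dec (Fin._≟_ {m}) ℤ._≟_) using (_∈?_)

  _≺_ : TEdge → TEdge → Set
  (_ , t) ≺ (_ , t′) = t ℤ.< t′

  chronological : ∀ {es} → Linked Consecutive es → AllPairs _≺_ es
  chronological = Linked⇒AllPairs <-trans ∘ Linked.map proj₂

  first-earliest : ∀ {x xs y} → AllPairs _≺_ (x ∷ xs) → y ∈ x ∷ xs → ¬ y ≺ x
  first-earliest _        (here refl)  = <-irrefl refl
  first-earliest (x≺ ∷ _) (there y∈xs) = <-asym (All.lookup x≺ y∈xs)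

  on-base-path : ∀ {x} → IsTemporalEdge x → ∃[ i ] x ∈ base i
  on-base-path {e , t} x∈G with i , p , eq ← Equivalence.to (cover e t) x∈G =
    i , subst (_∈ base i) eq (∈-lookup p)

  IsTemporalPath-contiguous : ∀ {b p} → ContiguousIn b p → IsTemporalPath p → IsTemporalPath b
  IsTemporalPath-contiguous {b} (pre , _ , refl) (edges , linked) =
    ++⁻ˡ b (++⁻ʳ pre edges) , Linked-++⁻ˡ b (Linked-++⁻ʳ pre linked)

  FromTo-++ : ∀ {u w v} xs {ys} → FromTo u w xs → FromTo w v ys → FromTo u v (xs ++ ys)
  FromTo-++ []       refl          p = p
  FromTo-++ (_ ∷ xs) (refl , p₁) p₂ = refl , FromTo-++ xs p₁ p₂

  FromTo-drop : ∀ {u v} xs {y ys} → FromTo u v (xs ++ y ∷ ys) → FromTo (head (proj₁ y)) v ys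
  FromTo-drop []       (_ , p) = p
  FromTo-drop (_ ∷ xs) (_ , p) = FromTo-drop xs p

  Linked⇒FromTo : ∀ xs {x y u} → List.head (xs ∷ʳ y) ≡ just x → tail (proj₁ x) ≡ u →
                  Linked Consecutive (xs ∷ʳ y) → FromTo u (head (proj₁ y)) (xs ∷ʳ y)
  Linked⇒FromTo []           refl t _       = t , refl
  Linked⇒FromTo (_ ∷ [])     refl t (r ∷ _) = t , sym (proj₁ r) , refl
  Linked⇒FromTo (_ ∷ c ∷ xs) refl t (r ∷ l) = t , Linked⇒FromTo (c ∷ xs) refl (sym (proj₁ r)) l

  TemporalPathFromTo-drop : ∀ {u v} xs {y ys} → TemporalPathFromTo u v (xs ++ y ∷ ys) →
                            TemporalPathFromTo (head (proj₁ y)) v ys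
  TemporalPathFromTo-drop xs ((edges , linked) , fromTo) =
    (All.tail (++⁻ʳ xs edges) , Linked.tail (Linked-++⁻ʳ xs linked)) , FromTo-drop xs fromTo

  TemporalPathFromTo-splice : ∀ {u v} xs {y ys} →
    TemporalPathFromTo u (head (proj₁ y)) (xs ∷ʳ y) → TemporalPathFromTo (head (proj₁ y)) v ys →
    Connected Consecutive (just y) (List.head ys) → TemporalPathFromTo u v ((xs ∷ʳ y) ++ ys)
  TemporalPathFromTo-splice xs ((edges₁ , linked₁) , fromTo₁) ((edges₂ , linked₂) , fromTo₂) y~ys =
    (++⁺ edges₁ edges₂ , Linked-∷ʳ-++ xs linked₁ (y~ys ∷′ linked₂)) , FromTo-++ (xs ∷ʳ _) fromTo₁ fromTo₂

  Meets : List TEdge → Fin k → Set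
  Meets es i = Any (_∈ base i) es

  segment-to-last-visit : ∀ {x rest i} → Linked Consecutive (x ∷ rest) → x ∈ base i →
    ∃[ A ] ∃[ y ] ∃[ B ] ∃[ C ] (x ∷ rest ≡ A ++ y ∷ B × All (_∉ base i) B ×
                                 ContiguousIn (C ∷ʳ y) (base i) × List.head (C ∷ʳ y) ≡ just x)
  segment-to-last-visit {x} {rest} {i} linked x∈i
    with A , y , B , split , y∈i , B∌i ← split-last (_∈? base i) {x ∷ rest} (here x∈i)
    with C , segment⊆i , segmentHead ← segment-from-to (chronological (proj₂ (isPath i))) x∈i y∈i
           (first-earliest (chronological linked) (subst (y ∈_) (sym split) (∈-insert A)))
    = A , y , B , C , split , B∌i , segment⊆i , segmentHead

  -- sameHead lets a segment ending in y be spliced in front of the shortcut of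
  -- the path after y; metByEs keeps the blocks of that shortcut off the
  -- base-path of the segment, which the path after y avoids.
  record Shortcut (u v : Vertex) (es : List TEdge) : Set where
    field
      path        : List TEdge
      blocks      : List (Fin k × List TEdge)
      pathFromTo  : TemporalPathFromTo u v path
      concat≡path : concat (map proj₂ blocks) ≡ path
      contiguous  : All (λ ib → ContiguousIn (proj₂ ib) (base (proj₁ ib))) blocks
      unique      : Unique (map proj₁ blocks)
      sameHead    : List.head path ≡ List.head es
      metByEs     : All (Meets es) (map proj₁ blocks)

  shortcut : ∀ {u v} es → Acc _<_ (length es) → TemporalPathFromTo u v es → Shortcut u v es
  shortcut [] _ (_ , u≡v) = record
    { path = [] ; blocks = [] ; pathFromTo = ([] , []) , u≡v ; concat≡path = refl
    ; contiguous = [] ; unique = [] ; sameHead = refl ; metByEs = [] }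
  shortcut {u} {v} (x ∷ rest) (acc rs) tp@((x∈G ∷ _ , linked) , tail≡u , _)
    with i , x∈i ← on-base-path x∈G
    with A , y , B , C , split , B∌i , segment⊆i , segmentHead ← segment-to-last-visit linked x∈i
    = record
    { path        = segment ++ path
    ; blocks      = (i , segment) ∷ blocks
    ; pathFromTo  = TemporalPathFromTo-splice C segmentPath pathFromTo y~path
    ; concat≡path = cong (segment ++_) concat≡path
    ; contiguous  = segment⊆i ∷ contiguous
    ; unique      = All.map avoided metByEs ∷ unique
    ; sameHead    = head-++ segment path segmentHead
    ; metByEs     = here x∈i ∷ All.map met-by-es metByEs
    }
    where
    segment : List TEdge
    segment = C ∷ʳ y

    tp′ : TemporalPathFromTo u v (A ++ y ∷ B)
    tp′ = subst (TemporalPathFromTo u v) split tp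

    B-shorter : length B < length (x ∷ rest)
    B-shorter = subst (λ es → length B < length es) (sym split) (length-++-≤ʳ (y ∷ B) {A})

    open Shortcut (shortcut B (rs B-shorter) (TemporalPathFromTo-drop A tp′))

    segmentPath : TemporalPathFromTo u (head (proj₁ y)) segment
    segmentPath = let segmentTemporal = IsTemporalPath-contiguous segment⊆i (isPath i) in
      segmentTemporal , Linked⇒FromTo C segmentHead tail≡u (proj₂ segmentTemporal)

    y~path : Connected Consecutive (just y) (List.head path)
    y~path = subst (Connected Consecutive (just y)) (sym sameHead)
                   (Linked.head′ (Linked-++⁻ʳ A (proj₂ (proj₁ tp′))))

    avoided : ∀ {j} → Meets B j → i ≢ j
    avoided met refl = All¬⇒¬Any B∌i met

    met-by-es : ∀ {j} → Meets B j → Meets (x ∷ rest) j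
    met-by-es met = subst (Any _) (sym split) (++⁺ʳ A (there met))

lemma3 : (H : TemporalKPathGraph) → let open TemporalKPathGraph H in
         ∀ (u v : Vertex) → Reaches u v →
         ∃[ es ] (TemporalPathFromTo u v es × OneSegmentPerBasePath es)
lemma3 H u v (es , tp) = path , pathFromTo , blocks , concat≡path , contiguous , unique
  where open Shortcut (shortcut H es (<-wellFounded (length es)) tp)
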